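{- For any integers $k\ge n\ge1$, any set of $k$ distinct binary strings contains $n$ strings sharing a common prefix of length at least $\lfloor\log(k/n)\rfloor$.
   Context: Binary strings are finite sequences over $\{0,1\}$, possibly empty. $n$ strings share a common prefix of length at least $m$ if each has length at least $m$ and they agree in their first $m$ symbols. Logarithms are binary. -}

module Defs where

open import Data.Bool using (Bool)
open import Data.List using (List; length; take)
open import Data.Nat using (ℕ; _≤_)
open import Data.Fin using (Fin)
open import Data.Product using (_×_; ∃)
open import Relation.Binary.PropositionalEquality using (_≡_)

BinString : Set
BinString = List Bool

ShareCommonPrefix : ℕ → {n : ℕ} → (Fin n → BinString) → Set
ShareCommonPrefix m {n} s =
  (∀ i → m ≤ length (s i)) × (∀ i j → take m (s i) ≡ take m (s j))

-- Among distinct strings at most one is empty and every other one starts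
-- with 0 or 1, so among 2·m distinct strings at least m share their
-- first symbol, and their tails are again distinct.  Repeating this L times
-- turns 2^L · n distinct strings into n that agree on their first L symbols;
-- with L = ⌊log₂ (k / n)⌋ we have 2^L · n ≤ (k / n) · n ≤ k.

module Submission where

open import Defs
open import Data.Nat using (ℕ; _≤_; _/_; NonZero)
open import Data.Nat.Logarithm using (⌊log₂_⌋)
open import Data.Fin using (Fin)
open import Data.Product using (Σ; _×_)
open import Function using (_∘_)
open import Function.Definitions using (Injective)
open import Relation.Binary.PropositionalEquality using (_≡_)

open import Data.Bool using (Bool; true; false) renaming (_≟_ to _≟ᵇ_)
open import Data.Empty using (⊥-elim)
open import Data.Fin using (zero; suc; inject≤)
open import Data.Fin.Properties using (inject≤-injective)
open import Data.List using (List; []; _∷_; length; take; drop; filter; lookup; allFin)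
open import Data.List.Membership.Propositional.Properties using (∈-lookup)
open import Data.List.Properties using (≡-dec; ∷-injectiveˡ; length-tabulate)
open import Data.List.Relation.Binary.Sublist.Propositional using (_⊆_; []; _∷_; _∷ʳ_; ⊆-refl; ⊆-trans)
open import Data.List.Relation.Binary.Sublist.Propositional.Properties using (All-resp-⊆; filter-⊆)
open import Data.List.Relation.Unary.All as All using (All; []; _∷_)
open import Data.List.Relation.Unary.All.Properties using (all-filter)
open import Data.List.Relation.Unary.AllPairs as AllPairs using (AllPairs; []; _∷_)
import Data.List.Relation.Unary.AllPairs.Properties as AllPairs
open import Data.List.Relation.Unary.Unique.Propositional using (Unique)
open import Data.List.Relation.Unary.Unique.Propositional.Properties using (allFin⁺)
open import Data.Nat using (zero; suc; _+_; _*_; _^_; _<_; ⌊_/2⌋; ⌈_/2⌉; z≤n; s≤s; _≤?_; >-nonZero)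
open import Data.Nat.DivMod using (m/n*n≤m; m≥n⇒m/n>0)
open import Data.Nat.Logarithm.Core using (⌊log2⌋)
open import Data.Nat.Properties
open import Data.Product using (∃; ∃₂; _,_; proj₁; proj₂)
open import Data.Sum using (_⊎_; inj₁; inj₂; [_,_]′)
open import Function using (_on_)
open import Induction.WellFounded using (Acc; acc)
open import Relation.Binary.PropositionalEquality using (_≢_; refl; sym; trans; cong)
open import Relation.Nullary using (yes; no; map′; contradiction)
open import Relation.Unary using (Decidable)

2*⌊n/2⌋≤n : ∀ n → 2 * ⌊ n /2⌋ ≤ n
2*⌊n/2⌋≤n n = begin
  2 * ⌊ n /2⌋        ≡⟨ cong (⌊ n /2⌋ +_) (+-identityʳ ⌊ n /2⌋) ⟩
  ⌊ n /2⌋ + ⌊ n /2⌋  ≤⟨ +-monoʳ-≤ ⌊ n /2⌋ (⌊n/2⌋≤⌈n/2⌉ n) ⟩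
  ⌊ n /2⌋ + ⌈ n /2⌉  ≡⟨ ⌊n/2⌋+⌈n/2⌉≡n n ⟩
  n                  ∎
  where open ≤-Reasoning

2^⌊log2⌋[1+n]≤1+n : ∀ n (rec : Acc _<_ (suc n)) → 2 ^ ⌊log2⌋ (suc n) rec ≤ suc n
2^⌊log2⌋[1+n]≤1+n zero    _        = ≤-refl
2^⌊log2⌋[1+n]≤1+n (suc n) (acc rs) = begin
  2 * 2 ^ ⌊log2⌋ (suc ⌊ n /2⌋) _ ≤⟨ *-monoʳ-≤ 2 (2^⌊log2⌋[1+n]≤1+n ⌊ n /2⌋ _) ⟩
  2 * suc ⌊ n /2⌋               ≡⟨ *-suc 2 ⌊ n /2⌋ ⟩
  2 + 2 * ⌊ n /2⌋               ≤⟨ +-monoʳ-≤ 2 (2*⌊n/2⌋≤n n) ⟩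
  2 + n                         ∎
  where open ≤-Reasoning

2^⌊log₂n⌋≤n : ∀ n .{{_ : NonZero n}} → 2 ^ ⌊log₂ n ⌋ ≤ n
2^⌊log₂n⌋≤n (suc n) = 2^⌊log2⌋[1+n]≤1+n n _

pigeonhole-2 : ∀ {m a b} → 2 * m ≤ suc (a + b) → m ≤ a ⊎ m ≤ b
pigeonhole-2 {m} {a} {b} 2m≤ with m ≤? a | m ≤? b
... | yes m≤a | _       = inj₁ m≤a
... | no _    | yes m≤b = inj₂ m≤b
... | no m≰a  | no m≰b  = contradiction 2m≤ (<⇒≱ (begin-strict
  suc (a + b)       <⟨ n<1+n (suc (a + b)) ⟩
  suc (suc a + b)   ≡⟨ sym (+-suc (suc a) b) ⟩
  suc a + suc b     ≤⟨ +-mono-≤ (≰⇒> m≰a) (≰⇒> m≰b) ⟩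
  m + m             ≡⟨ cong (m +_) (sym (+-identityʳ m)) ⟩
  2 * m             ∎))
  where open ≤-Reasoning

StartsWith : Bool → BinString → Set
StartsWith b s = s ≡ b ∷ drop 1 s

startsWith? : ∀ b → Decidable (StartsWith b)
startsWith? b []      = no λ ()
startsWith? b (c ∷ t) = map′ (cong (_∷ t)) ∷-injectiveˡ (c ≟ᵇ b)

HasPrefix : ℕ → BinString → BinString → Set
HasPrefix L w s = L ≤ length s × take L s ≡ w

HasPrefix-∷ : ∀ {b L w s} → StartsWith b s → HasPrefix L w (drop 1 s) →
              HasPrefix (suc L) (b ∷ w) s
HasPrefix-∷ {b} {s = _ ∷ _} refl (L≤ , w≡) = s≤s L≤ , cong (b ∷_) w≡

module _ {A : Set} where

  AllPairs-resp-⊆ : ∀ {R : A → A → Set} {xs ys} → ys ⊆ xs → AllPairs R xs → AllPairs R ys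
  AllPairs-resp-⊆ []         []       = []
  AllPairs-resp-⊆ (_ ∷ʳ τ)   (_ ∷ rs) = AllPairs-resp-⊆ τ rs
  AllPairs-resp-⊆ (refl ∷ τ) (r ∷ rs) = All-resp-⊆ τ r ∷ AllPairs-resp-⊆ τ rs

  lookup-injective : ∀ {xs : List A} → Unique xs → Injective _≡_ _≡_ (lookup xs)
  lookup-injective (_  ∷ _) {zero}  {zero}  _ = refl
  lookup-injective (x∉ ∷ _) {zero}  {suc j} e = contradiction e (All.lookup x∉ (∈-lookup j))
  lookup-injective (x∉ ∷ _) {suc i} {zero}  e = contradiction (sym e) (All.lookup x∉ (∈-lookup i))
  lookup-injective (_  ∷ u) {suc i} {suc j} e = cong suc (lookup-injective u e)

  select-distinct : ∀ {P : A → Set} {n ys} → Unique ys → n ≤ length ys → All P ys →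
                    Σ (Fin n → A) λ ι → Injective _≡_ _≡_ ι × (∀ i → P (ι i))
  select-distinct {n = n} {ys} u n≤ ps =
      lookup ys ∘ position
    , (λ e → inject≤-injective n≤ n≤ _ _ (lookup-injective u e))
    , λ i → All.lookup ps (∈-lookup (position i))
    where
    position : Fin n → Fin (length ys)
    position i = inject≤ i n≤

  length≤1-of-constant : ∀ {g : A → BinString} {c ys} →
                         AllPairs (_≢_ on g) ys → All (λ y → g y ≡ c) ys → length ys ≤ 1
  length≤1-of-constant []                  []             = z≤n
  length≤1-of-constant (_ ∷ [])            _              = s≤s z≤n
  length≤1-of-constant ((x≢y ∷ _) ∷ _ ∷ _) (gx≡c ∷ gy≡c ∷ _) = ⊥-elim (x≢y (trans gx≡c (sym gy≡c)))

  empties : (A → BinString) → List A → List A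
  empties g = filter (λ x → ≡-dec _≟ᵇ_ (g x) [])

  branch : Bool → (A → BinString) → List A → List A
  branch b g = filter (startsWith? b ∘ g)

  length-empties+branches : ∀ g xs →
    length (empties g xs) + (length (branch false g xs) + length (branch true g xs)) ≡ length xs
  length-empties+branches g []       = refl
  length-empties+branches g (x ∷ xs) with g x
  ... | []        = cong suc (length-empties+branches g xs)
  ... | false ∷ _ = trans (+-suc _ _) (cong suc (length-empties+branches g xs))
  ... | true  ∷ _ = trans (cong (length (empties g xs) +_) (+-suc _ _))
                      (trans (+-suc _ _) (cong suc (length-empties+branches g xs)))

  large-branch : ∀ {g xs} m → AllPairs (_≢_ on g) xs → 2 * m ≤ length xs →
                 ∃ λ b → m ≤ length (branch b g xs)
  large-branch {g} {xs} m distinct 2m≤ =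
    [ (false ,_) , (true ,_) ]′ (pigeonhole-2 (≤-trans 2m≤ length≤))
    where
    length≤ : length xs ≤ 1 + (length (branch false g xs) + length (branch true g xs))
    length≤ = begin
      length xs                                                  ≡⟨ sym (length-empties+branches g xs) ⟩
      length (empties g xs) + _                                  ≤⟨ +-monoˡ-≤ _ (length≤1-of-constant
                                                                      (AllPairs.filter⁺ _ distinct) (all-filter _ xs)) ⟩
      1 + (length (branch false g xs) + length (branch true g xs)) ∎
      where open ≤-Reasoning

  branch-tails-distinct : ∀ {g xs} b → AllPairs (_≢_ on g) xs →
                          AllPairs (_≢_ on (drop 1 ∘ g)) (branch b g xs)
  branch-tails-distinct {g} {xs} b distinct =
    tails-distinct (all-filter (startsWith? b ∘ g) xs) (AllPairs.filter⁺ _ distinct)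
    where
    tails-distinct : ∀ {ys} → All (StartsWith b ∘ g) ys → AllPairs (_≢_ on g) ys →
                     AllPairs (_≢_ on (drop 1 ∘ g)) ys
    tails-distinct []         []           = []
    tails-distinct (sx ∷ sys) (x≢ys ∷ ys!) =
      All.zipWith (λ (sy , x≢y) tails≡ → x≢y (trans sx (trans (cong (b ∷_) tails≡) (sym sy))))
        (sys , x≢ys) ∷ tails-distinct sys ys!

  large-prefix-class : ∀ L n (g : A → BinString) xs →
    AllPairs (_≢_ on g) xs → 2 ^ L * n ≤ length xs →
    ∃₂ λ w ys → ys ⊆ xs × n ≤ length ys × All (HasPrefix L w ∘ g) ys
  large-prefix-class zero n g xs _ n≤ =
    [] , xs , ⊆-refl , ≤-trans (≤-reflexive (sym (*-identityˡ n))) n≤ , All.universal (λ _ → z≤n , refl) xs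
  large-prefix-class (suc L) n g xs distinct 2^L*n≤
    with b , big ← large-branch (2 ^ L * n) distinct (≤-trans (≤-reflexive (sym (*-assoc 2 (2 ^ L) n))) 2^L*n≤)
    with w , ys , ys⊆ , n≤ , prefixed ←
           large-prefix-class L n (drop 1 ∘ g) (branch b g xs) (branch-tails-distinct b distinct) big
    = b ∷ w , ys , ⊆-trans ys⊆ (filter-⊆ _ xs) , n≤
    , All.zipWith (λ (starts , prefix) → HasPrefix-∷ starts prefix)
        (All-resp-⊆ ys⊆ (all-filter (startsWith? b ∘ g) xs) , prefixed)

corollary5p5 : (k n : ℕ) → .{{_ : NonZero n}} → n ≤ k →
    (s : Fin k → BinString) → Injective _≡_ _≡_ s →
    Σ (Fin n → Fin k) λ ι → Injective _≡_ _≡_ ι ×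
    ShareCommonPrefix ⌊log₂ (k / n) ⌋ (s ∘ ι)
corollary5p5 k n n≤k s s-inj =
  let w , ys , ys⊆ , n≤ , prefixed = large-prefix-class L n s (allFin k) distinct bound
      ι , ι-inj , ι-prefixed = select-distinct (AllPairs-resp-⊆ ys⊆ (allFin⁺ k)) n≤ prefixed
  in ι , ι-inj , proj₁ ∘ ι-prefixed , λ i j → trans (proj₂ (ι-prefixed i)) (sym (proj₂ (ι-prefixed j)))
  where
  L : ℕ
  L = ⌊log₂ (k / n) ⌋
  distinct : AllPairs (_≢_ on s) (allFin k)
  distinct = AllPairs.map (λ i≢j → i≢j ∘ s-inj) (allFin⁺ k)
  bound : 2 ^ L * n ≤ length (allFin k)
  bound = begin
    2 ^ L * n          ≤⟨ *-monoˡ-≤ n (2^⌊log₂n⌋≤n (k / n) {{>-nonZero (m≥n⇒m/n>0 n≤k)}}) ⟩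
    k / n * n          ≤⟨ m/n*n≤m k n ⟩
    k                  ≡⟨ sym (length-tabulate _) ⟩
    length (allFin k)  ∎
    where open ≤-Reasoning
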